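{- Let $\mathcal{G}_S=(L_1,L_2,l_0,X,\mathit{Act},\mathit{Obs},\mathit{flow},E,\mathit{lbl})$ be an initialized singular game, let $\mathcal{G}_W$ be the game obtained from $\mathcal{G}_S$ by the flow-normalization construction described in the context, and let $\gamma_1:Q(\mathcal{G}_S)\to Q(\mathcal{G}_W)$ be the (bijective) map $\gamma_1(l,v)=(l,v^*)$, where $v^*(x)=v(x)/\mathit{flow}(l,x)$ if $\mathit{flow}(l,x)\neq 0$ and $v^*(x)=v(x)$ otherwise. Then the relation $\gamma_1^{ -1}=\{(\gamma_1(q),q): q\in Q(\mathcal{G}_S)\}$ witnesses $T(\mathcal{G}_W)\preceq_s T(\mathcal{G}_S)$.
   Context: A simple compact constraint over a finite set $X$ of real variables is a conjunction containing, for each $x\in X$, exactly one conjunct $x\in I$ with $I$ a compact interval with rational endpoints; $\varphi(x)$ denotes that interval. An initialized singular game is a tuple $\mathcal{G}=(L_1,L_2,l_0,X,\mathit{Act},\mathit{Obs},\mathit{flow},E,\mathit{lbl})$ where $L_1,L_2$ are disjoint finite sets of locations (owned by Player 1 and Player 2 respectively), $l_0\in L_1$, $X$ is a finite set of real variables, $\mathit{Act}$ a finite set of actions, $\mathit{Obs}$ a finite set of observations, $\mathit{lbl}:L_1\cup L_2\to\mathit{Obs}$, $\mathit{flow}:(L_1\cup L_2)\times X\to\mathbb{Q}$, and $E$ is a set of edges $e=(l,a,\varphi_e,\mathit{rst}_e,l')$ with $l,l'\in L_1\cup L_2$, $a\in\mathit{Act}$, $\varphi_e$ a simple compact constraint over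 $X$, and $\mathit{rst}_e:X\to\mathbb{Q}\cup\{\bot\}$, such that $\mathit{flow}(l,x)\neq\mathit{flow}(l',x)$ implies $\mathit{rst}_e(x)\neq\bot$. Semantics: the transition system $T(\mathcal{G})$ has configurations $Q(\mathcal{G})=(L_1\cup L_2)\times\mathbb{R}^X$, initial configuration $(l_0,\vec 0)$, moves $\mathit{Act}\times\mathbb{R}_{\ge 0}$, and a transition $(l,v)\xrightarrow{(a,t)}(l',v')$ whenever there is an edge $e=(l,a,\varphi_e,\mathit{rst}_e,l')$ such that for every $x\in X$: $v(x)+t\cdot\mathit{flow}(l,x)\in\varphi_e(x)$, and $v'(x)=\mathit{rst}_e(x)$ if $\mathit{rst}_e(x)\neq\bot$, $v'(x)=v(x)+t\cdot\mathit{flow}(l,x)$ otherwise. $Q_i(\mathcal{G})$ is the set of configurations whose location lies in $L_i$; $\mathit{lbl}$ is extended to configurations via their location. Alternating simulation: for two such games $\mathcal{G}^1,\mathcal{G}^2$ with the same observation set, a relation $R\subseteq (Q_1(\mathcal{G}^1)\times Q_1(\mathcal{G}^2))\cup(Q_2(\mathcal{G}^1)\times Q_2(\mathcal{G}^2))$ is a simulation if for every $(p,q)\in R$: (1) $\mathit{lbl}^1(p)=\mathit{lbl}^2(q)$; (2) if $p\in Q_1(\mathcal{G}^1)$, then for every move $m$ and every transition $p\xrightarrow{m}p'$ in $T(\mathcal{G}^1)$ there exist a move $m'$ and a transition $q\xrightarrow{m'}q'$ in $T(\mathcal{G}^2)$ with $(p',q')\in R$; (3) if $p\in Q_2(\mathcal{G}^1)$,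 then for every move $m'$ and every transition $q\xrightarrow{m'}q'$ in $T(\mathcal{G}^2)$ there exist a move $m$ and a transition $p\xrightarrow{m}p'$ in $T(\mathcal{G}^1)$ with $(p',q')\in R$. $R$ witnesses $T(\mathcal{G}^1)\preceq_s T(\mathcal{G}^2)$ if $R$ is a simulation containing the pair of initial configurations. Construction of $\mathcal{G}_W=(L_1,L_2,l_0,X,\mathit{Act},\mathit{Obs},\mathit{flow}_W,E_W,\mathit{lbl})$ from $\mathcal{G}_S$: locations, initial location, variables, actions, observations and labeling are unchanged; $\mathit{flow}_W(l,x)=0$ if $\mathit{flow}(l,x)=0$ and $\mathit{flow}_W(l,x)=1$ otherwise; for every edge $e=(l,a,\varphi_e,\mathit{rst}_e,l')\in E$ there is an edge $e_W=(l,a,\varphi_{e_W},\mathit{rst}_{e_W},l')\in E_W$ (and $E_W$ has no other edges), where $\varphi_{e_W}$ is the constraint with conjuncts $x\in\varphi_{e_W}(x)$, $\varphi_{e_W}(x)=\{c/\mathit{flow}(l,x): c\in\varphi_e(x)\}$ if $\mathit{flow}(l,x)\neq0$ and $\varphi_{e_W}(x)=\varphi_e(x)$ otherwise; and $\mathit{rst}_{e_W}(x)=\bot$ if $\mathit{rst}_e(x)=\bot$, $\mathit{rst}_{e_W}(x)=\mathit{rst}_e(x)/\mathit{flow}(l',x)$ if $\mathit{rst}_e(x)\neq\bot$ and $\mathit{flow}(l',x)\neq 0$, and $\mathit{rst}_{e_W}(x)=\mathit{rst}_e(x)$ if $\mathit{rst}_e(x)\neq\bot$ and $\mathit{flow}(l',x)=0$.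 -}

module Defs where

open import Level using (0ℓ)
open import Data.Nat as ℕ using (ℕ; zero; suc)
open import Data.Integer as ℤ using (ℤ; +_; -[1+_])
open import Data.Rational as ℚ using (ℚ; 0ℚ; 1ℚ; ↥_; ↧ₙ_; _÷_; _⊓_; _⊔_; ≢-nonZero)
open import Data.Rational.Properties using (_≟_)
open import Data.Fin using (Fin)
open import Data.Sum using (_⊎_; inj₁; inj₂)
open import Data.Product using (Σ; ∃; _×_; _,_)
open import Data.Maybe using (Maybe; just; nothing)
open import Data.List using (List; map)
open import Data.List.Membership.Propositional using (_∈_)
open import Relation.Nullary using (¬_; yes; no)
open import Relation.Binary.PropositionalEquality using (_≡_; _≢_)
open import Algebra.Structures using (IsCommutativeRing)
open import Relation.Binary.Structures using (IsTotalOrder)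

-- The real numbers, axiomatised as a complete ordered field
-- (equality is propositional equality on the carrier).  Any two such
-- structures are isomorphic, so quantifying over them amounts to
-- speaking about ℝ.

record RealField : Set₁ where
  infixl 6 _+_
  infixl 7 _*_
  infix  4 _≤_
  field
    Carrier : Set
    _+_ _*_ : Carrier → Carrier → Carrier
    -_      : Carrier → Carrier
    _⁻¹     : Carrier → Carrier      -- total; only meaningful off 0
    0# 1#   : Carrier
    _≤_     : Carrier → Carrier → Set
    isCommutativeRing : IsCommutativeRing _≡_ _+_ _*_ -_ 0# 1#
    0≢1     : 0# ≢ 1#
    ⁻¹-inverse : ∀ x → x ≢ 0# → x * (x ⁻¹) ≡ 1#
    isTotalOrder : IsTotalOrder _≡_ _≤_
    +-mono-≤  : ∀ {x y} z → x ≤ y → x + z ≤ y + z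
    *-nonneg  : ∀ {x y} → 0# ≤ x → 0# ≤ y → 0# ≤ x * y
    sup : (P : Carrier → Set) → (Σ Carrier P) →
          (Σ Carrier λ b → ∀ x → P x → x ≤ b) →
          Σ Carrier λ s → (∀ x → P x → x ≤ s) ×
                          (∀ b → (∀ x → P x → x ≤ b) → s ≤ b)

  fromℕ : ℕ → Carrier
  fromℕ zero    = 0#
  fromℕ (suc n) = 1# + fromℕ n

  fromℤ : ℤ → Carrier
  fromℤ (+ n)      = fromℕ n
  fromℤ -[1+ n ]   = - fromℕ (suc n)

  fromℚ : ℚ → Carrier
  fromℚ q = fromℤ (↥ q) * (fromℕ (↧ₙ q)) ⁻¹

record Interval : Set where
  constructor [_,_]
  field
    lo hi : ℚ

Loc : ℕ → ℕ → Set
Loc n₁ n₂ = Fin n₁ ⊎ Fin n₂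

data Player : Set where
  P1 P2 : Player

owner : ∀ {n₁ n₂} → Loc n₁ n₂ → Player
owner (inj₁ _) = P1
owner (inj₂ _) = P2

-- an edge (l , a , φ , rst , l'); the simple compact constraint φ gives
-- one interval per variable; rst x = nothing encodes ⊥
record Edge (n₁ n₂ nX nA : ℕ) : Set where
  field
    src   : Loc n₁ n₂
    act   : Fin nA
    guard : Fin nX → Interval
    rst   : Fin nX → Maybe ℚ
    tgt   : Loc n₁ n₂

-- variables X = Fin nX, actions Act = Fin nA, observations Obs = Fin nO;
-- the initial location l₀ lies in L₁; the finite edge set is a list
record Game (n₁ n₂ nX nA nO : ℕ) : Set where
  field
    l₀    : Fin n₁
    flow  : Loc n₁ n₂ → Fin nX → ℚ
    edges : List (Edge n₁ n₂ nX nA)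
    lbl   : Loc n₁ n₂ → Fin nO

WellFormed : ∀ {n₁ n₂ nX nA nO} → Game n₁ n₂ nX nA nO → Set
WellFormed {nX = nX} G =
  ∀ e → e ∈ edges → (∀ (x : Fin nX) → Interval.lo (Edge.guard e x) ℚ.≤ Interval.hi (Edge.guard e x))
                  × (∀ (x : Fin nX) → flow (Edge.src e) x ≢ flow (Edge.tgt e) x → Edge.rst e x ≢ nothing)
  where open Game G

module Semantics (ℝ : RealField) where
  open RealField ℝ

  Config : ℕ → ℕ → ℕ → Set
  Config n₁ n₂ nX = Loc n₁ n₂ × (Fin nX → Carrier)

  Move : ℕ → Set
  Move nA = Fin nA × Carrier    -- (a , t), with t ≥ 0 required in Step

  _∈I_ : Carrier → Interval → Set
  r ∈I [ a , b ] = (fromℚ a ≤ r) × (r ≤ fromℚ b)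

  initial : ∀ {n₁ n₂ nX nA nO} → Game n₁ n₂ nX nA nO → Config n₁ n₂ nX
  initial G = inj₁ (Game.l₀ G) , λ _ → 0#

  resetVal : Maybe ℚ → Carrier → Carrier
  resetVal (just c) _ = fromℚ c
  resetVal nothing  r = r

  Step : ∀ {n₁ n₂ nX nA nO} → Game n₁ n₂ nX nA nO →
         Config n₁ n₂ nX → Move nA → Config n₁ n₂ nX → Set
  Step G (l , v) (a , t) (l' , v') =
    (0# ≤ t) ×
    Σ _ λ e → (e ∈ Game.edges G) ×
      (Edge.src e ≡ l) × (Edge.act e ≡ a) × (Edge.tgt e ≡ l') ×
      (∀ x → let r = v x + t * fromℚ (Game.flow G l x) in
             (r ∈I Edge.guard e x) × (v' x ≡ resetVal (Edge.rst e x) r))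

  IsAltSimulation : ∀ {n₁ n₂ m₁ m₂ nX nY nA nB nO} →
    (G¹ : Game n₁ n₂ nX nA nO) (G² : Game m₁ m₂ nY nB nO) →
    (Config n₁ n₂ nX → Config m₁ m₂ nY → Set) → Set
  IsAltSimulation G¹ G² R = ∀ p q → R p q →
      (owner (Data.Product.proj₁ p) ≡ owner (Data.Product.proj₁ q))
    × (Game.lbl G¹ (Data.Product.proj₁ p) ≡ Game.lbl G² (Data.Product.proj₁ q))
    × (owner (Data.Product.proj₁ p) ≡ P1 → ∀ m p' → Step G¹ p m p' →
         Σ _ λ m' → Σ _ λ q' → Step G² q m' q' × R p' q')
    × (owner (Data.Product.proj₁ p) ≡ P2 → ∀ m' q' → Step G² q m' q' →
         Σ _ λ m → Σ _ λ p' → Step G¹ p m p' × R p' q')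

  Witnesses : ∀ {n₁ n₂ m₁ m₂ nX nY nA nB nO} →
    (G¹ : Game n₁ n₂ nX nA nO) (G² : Game m₁ m₂ nY nB nO) →
    (Config n₁ n₂ nX → Config m₁ m₂ nY → Set) → Set
  Witnesses G¹ G² R = IsAltSimulation G¹ G² R × R (initial G¹) (initial G²)

-- c / f for rational f ≠ 0 (and c itself when f = 0, never used there)
_/ℚ_ : ℚ → ℚ → ℚ
c /ℚ f with f ≟ 0ℚ
... | yes _  = c
... | no f≢0 = _÷_ c f {{≢-nonZero f≢0}}

scaleInterval : Interval → ℚ → Interval
scaleInterval [ a , b ] f = [ (a /ℚ f) ⊓ (b /ℚ f) , (a /ℚ f) ⊔ (b /ℚ f) ]

module _ {n₁ n₂ nX nA nO : ℕ} (G : Game n₁ n₂ nX nA nO) where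
  open Game G

  flowW : Loc n₁ n₂ → Fin nX → ℚ
  flowW l x with flow l x ≟ 0ℚ
  ... | yes _ = 0ℚ
  ... | no  _ = 1ℚ

  guardW : Loc n₁ n₂ → Interval → Fin nX → Interval
  guardW l I x with flow l x ≟ 0ℚ
  ... | yes _ = I
  ... | no  _ = scaleInterval I (flow l x)

  rstW : Loc n₁ n₂ → Maybe ℚ → Fin nX → Maybe ℚ
  rstW l' nothing  x = nothing
  rstW l' (just c) x with flow l' x ≟ 0ℚ
  ... | yes _ = just c
  ... | no  _ = just (c /ℚ flow l' x)

  edgeW : Edge n₁ n₂ nX nA → Edge n₁ n₂ nX nA
  edgeW e = record
    { src   = Edge.src e
    ; act   = Edge.act e
    ; guard = λ x → guardW (Edge.src e) (Edge.guard e x) x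
    ; rst   = λ x → rstW (Edge.tgt e) (Edge.rst e x) x
    ; tgt   = Edge.tgt e }

  normalize : Game n₁ n₂ nX nA nO
  normalize = record
    { l₀    = l₀
    ; flow  = flowW
    ; edges = map edgeW edges
    ; lbl   = lbl }

  module _ (ℝ : RealField) where
    open RealField ℝ
    open Semantics ℝ

    star : Loc n₁ n₂ → Fin nX → Carrier → Carrier
    star l x r with flow l x ≟ 0ℚ
    ... | yes _ = r
    ... | no  _ = r * (fromℚ (flow l x)) ⁻¹

    γ₁ : Config n₁ n₂ nX → Config n₁ n₂ nX
    γ₁ (l , v) = l , λ x → star l x (v x)

    γ₁⁻¹ : Config n₁ n₂ nX → Config n₁ n₂ nX → Set
    γ₁⁻¹ (l' , v') (l , v) = (l' ≡ l) × (∀ x → v' x ≡ star l x (v x))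

-- γ₁ divides each variable with non-zero flow by that flow, so in G_W it grows at rate 1
-- exactly when it grows at rate flow(l,x) in G_S: γ₁ commutes with the elapse of time.
-- A scaled guard is the image of the original guard under division by the flow (with its
-- endpoints swapped when the flow is negative), so the guard of e_W holds at γ₁(q) after
-- time t iff the guard of e holds at q after time t. A scaled reset value is the original
-- one divided by the flow of the target location, and a variable that is not reset keeps
-- its flow across the edge by well-formedness, so γ₁ also commutes with the jump. Hence
-- from related configurations each game matches every move of the other with the same
-- move along the corresponding edge, and the successors are again related.
module Submission where

open import Defs
open import Data.Nat as ℕ using (ℕ; zero; suc)

open import Level using (0ℓ)
import Data.Integer as ℤ
import Data.Integer.Properties as ℤ
open import Data.Rational as ℚ using (ℚ; 0ℚ; 1ℚ)
import Data.Rational.Properties as ℚ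
open import Data.Rational.Unnormalised as ℚᵘ using (ℚᵘ)
open import Data.Fin using (Fin)
open import Data.Sum using (inj₁; inj₂)
open import Data.Product using (Σ; _×_; _,_; proj₁; proj₂; swap)
open import Data.Product.Function.NonDependent.Propositional using (_×-⇔_)
open import Data.Maybe using (just; nothing)
open import Data.List.Membership.Propositional using (_∈_)
open import Data.List.Membership.Propositional.Properties using (∈-map⁺; ∈-map⁻)
open import Function.Bundles using (_⇔_; mk⇔; Equivalence)
import Function.Properties.Equivalence as ⇔
open import Relation.Nullary using (yes; no; contradiction)
open import Relation.Binary.PropositionalEquality hiding ([_])
open import Algebra.Bundles using (CommutativeRing)
open import Relation.Binary.Structures using (IsTotalOrder)

module OrderedFieldProperties (ℝ : RealField) where
  open RealField ℝ
  open IsTotalOrder isTotalOrder public using (total; antisym) renaming (refl to ≤-refl; trans to ≤-trans)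

  commutativeRing : CommutativeRing 0ℓ 0ℓ
  commutativeRing = record { isCommutativeRing = isCommutativeRing }

  open CommutativeRing commutativeRing
    using (_-_; +-comm; +-identityˡ; -‿inverseʳ; *-comm; *-assoc; *-identityˡ; *-identityʳ; zeroˡ;
           ring; *-commutativeSemigroup)
  open import Algebra.Properties.Ring ring
    using (-‿distribˡ-*; -‿distribʳ-*; -‿involutive; -0#≈0#; [y-z]x≈yx-zx; //-rightDividesˡ)
  open import Algebra.Properties.CommutativeSemigroup *-commutativeSemigroup using (interchange)
  open ≡-Reasoning

  +-monoʳ-≤ : ∀ z {x y} → x ≤ y → z + x ≤ z + y
  +-monoʳ-≤ z {x} {y} x≤y = subst₂ _≤_ (+-comm x z) (+-comm y z) (+-mono-≤ z x≤y)

  x≤y⇒0≤y-x : ∀ {x y} → x ≤ y → 0# ≤ y - x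
  x≤y⇒0≤y-x {x} x≤y = subst₂ _≤_ (-‿inverseʳ x) refl (+-mono-≤ (- x) x≤y)

  0≤y-x⇒x≤y : ∀ {x y} → 0# ≤ y - x → x ≤ y
  0≤y-x⇒x≤y {x} {y} 0≤y-x = subst₂ _≤_ (+-identityˡ x) (//-rightDividesˡ x y) (+-mono-≤ x 0≤y-x)

  neg-antimono-≤ : ∀ {x y} → x ≤ y → - y ≤ - x
  neg-antimono-≤ {x} {y} x≤y = 0≤y-x⇒x≤y (subst (0# ≤_) y-x≡-x--y (x≤y⇒0≤y-x x≤y))
    where
    y-x≡-x--y : y - x ≡ - x - - y
    y-x≡-x--y = trans (+-comm y (- x)) (cong (- x +_) (sym (-‿involutive y)))

  x≤0⇒0≤-x : ∀ {x} → x ≤ 0# → 0# ≤ - x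
  x≤0⇒0≤-x x≤0 = subst₂ _≤_ -0#≈0# refl (neg-antimono-≤ x≤0)

  0≤x⇒-x≤0 : ∀ {x} → 0# ≤ x → - x ≤ 0#
  0≤x⇒-x≤0 0≤x = subst₂ _≤_ refl -0#≈0# (neg-antimono-≤ 0≤x)

  -x*-x≡x*x : ∀ x → - x * - x ≡ x * x
  -x*-x≡x*x x = begin
    - x * - x      ≡⟨ sym (-‿distribˡ-* x (- x)) ⟩
    - (x * - x)    ≡⟨ cong -_ (sym (-‿distribʳ-* x x)) ⟩
    - - (x * x)    ≡⟨ -‿involutive (x * x) ⟩
    x * x          ∎

  square-nonNeg : ∀ x → 0# ≤ x * x
  square-nonNeg x with total 0# x
  ... | inj₁ 0≤x = *-nonneg 0≤x 0≤x
  ... | inj₂ x≤0 = subst (0# ≤_) (-x*-x≡x*x x) (*-nonneg (x≤0⇒0≤-x x≤0) (x≤0⇒0≤-x x≤0))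

  0≤1 : 0# ≤ 1#
  0≤1 = subst (0# ≤_) (*-identityˡ 1#) (square-nonNeg 1#)

  *-monoʳ-≤-nonNeg : ∀ {c x y} → 0# ≤ c → x ≤ y → x * c ≤ y * c
  *-monoʳ-≤-nonNeg {c} {x} {y} 0≤c x≤y =
    0≤y-x⇒x≤y (subst (0# ≤_) ([y-z]x≈yx-zx c y x) (*-nonneg (x≤y⇒0≤y-x x≤y) 0≤c))

  *-monoʳ-≤-nonPos : ∀ {c x y} → c ≤ 0# → x ≤ y → y * c ≤ x * c
  *-monoʳ-≤-nonPos {c} {x} {y} c≤0 x≤y =
    subst₂ _≤_ ( -[x*-c]≡x*c y) ( -[x*-c]≡x*c x) (neg-antimono-≤ (*-monoʳ-≤-nonNeg (x≤0⇒0≤-x c≤0) x≤y))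
    where
    -[x*-c]≡x*c : ∀ x → - (x * - c) ≡ x * c
    -[x*-c]≡x*c x = trans (cong -_ (sym (-‿distribʳ-* x c))) (-‿involutive (x * c))

  x*c*c⁻¹≡x : ∀ {c} → c ≢ 0# → ∀ x → x * c * c ⁻¹ ≡ x
  x*c*c⁻¹≡x {c} c≢0 x = begin
    x * c * c ⁻¹     ≡⟨ *-assoc x c (c ⁻¹) ⟩
    x * (c * c ⁻¹)   ≡⟨ cong (x *_) (⁻¹-inverse c c≢0) ⟩
    x * 1#           ≡⟨ *-identityʳ x ⟩
    x                ∎

  x*c⁻¹*c≡x : ∀ {c} → c ≢ 0# → ∀ x → x * c ⁻¹ * c ≡ x
  x*c⁻¹*c≡x {c} c≢0 x = begin
    x * c ⁻¹ * c     ≡⟨ *-assoc x (c ⁻¹) c ⟩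
    x * (c ⁻¹ * c)   ≡⟨ cong (x *_) (*-comm (c ⁻¹) c) ⟩
    x * (c * c ⁻¹)   ≡⟨ sym (*-assoc x c (c ⁻¹)) ⟩
    x * c * c ⁻¹     ≡⟨ x*c*c⁻¹≡x c≢0 x ⟩
    x                ∎

  x*c*[y*c⁻¹]≡x*y : ∀ {c} → c ≢ 0# → ∀ x y → x * c * (y * c ⁻¹) ≡ x * y
  x*c*[y*c⁻¹]≡x*y {c} c≢0 x y = begin
    x * c * (y * c ⁻¹)    ≡⟨ interchange x c y (c ⁻¹) ⟩
    x * y * (c * c ⁻¹)    ≡⟨ cong (x * y *_) (⁻¹-inverse c c≢0) ⟩
    x * y * 1#            ≡⟨ *-identityʳ (x * y) ⟩
    x * y                 ∎

  x*y≡1⇒x≢0 : ∀ {x y} → x * y ≡ 1# → x ≢ 0#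
  x*y≡1⇒x≢0 {x} {y} x*y≡1 x≡0 = 0≢1 (begin
    0#       ≡⟨ sym (zeroˡ y) ⟩
    0# * y   ≡⟨ cong (_* y) (sym x≡0) ⟩
    x * y    ≡⟨ x*y≡1 ⟩
    1#       ∎)

  ⁻¹-unique : ∀ {x y} → x * y ≡ 1# → y ≡ x ⁻¹
  ⁻¹-unique {x} {y} x*y≡1 = begin
    y              ≡⟨ sym (x*c*c⁻¹≡x (x*y≡1⇒x≢0 x*y≡1) y) ⟩
    y * x * x ⁻¹   ≡⟨ cong (_* x ⁻¹) (trans (*-comm y x) x*y≡1) ⟩
    1# * x ⁻¹      ≡⟨ *-identityˡ (x ⁻¹) ⟩
    x ⁻¹           ∎

  ⁻¹-* : ∀ {x y} → x ≢ 0# → y ≢ 0# → (x * y) ⁻¹ ≡ x ⁻¹ * y ⁻¹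
  ⁻¹-* {x} {y} x≢0 y≢0 = sym (⁻¹-unique (begin
    x * y * (x ⁻¹ * y ⁻¹)   ≡⟨ x*c*[y*c⁻¹]≡x*y y≢0 x (x ⁻¹) ⟩
    x * x ⁻¹                ≡⟨ ⁻¹-inverse x x≢0 ⟩
    1#                      ∎))

  ⁻¹-nonNeg : ∀ {c} → 0# ≤ c → c ≢ 0# → 0# ≤ c ⁻¹
  ⁻¹-nonNeg {c} 0≤c c≢0 =
    subst (0# ≤_) (x*c⁻¹*c≡x c≢0 (c ⁻¹)) (*-nonneg (square-nonNeg (c ⁻¹)) 0≤c)

  ⁻¹-nonPos : ∀ {c} → c ≤ 0# → c ≢ 0# → c ⁻¹ ≤ 0#
  ⁻¹-nonPos {c} c≤0 c≢0 =
    subst₂ _≤_ c*[c⁻¹*c⁻¹]≡c⁻¹ (zeroˡ (c ⁻¹ * c ⁻¹))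
      (*-monoʳ-≤-nonNeg (square-nonNeg (c ⁻¹)) c≤0)
    where
    c*[c⁻¹*c⁻¹]≡c⁻¹ : c * (c ⁻¹ * c ⁻¹) ≡ c ⁻¹
    c*[c⁻¹*c⁻¹]≡c⁻¹ = trans (*-comm c (c ⁻¹ * c ⁻¹)) (x*c⁻¹*c≡x c≢0 (c ⁻¹))

  *-⁻¹-≤⇔-nonNeg : ∀ {c x y} → 0# ≤ c → c ≢ 0# → (x * c ⁻¹ ≤ y * c ⁻¹) ⇔ (x ≤ y)
  *-⁻¹-≤⇔-nonNeg {c} {x} {y} 0≤c c≢0 = mk⇔
    (λ x/c≤y/c → subst₂ _≤_ (x*c⁻¹*c≡x c≢0 x) (x*c⁻¹*c≡x c≢0 y) (*-monoʳ-≤-nonNeg 0≤c x/c≤y/c))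
    (*-monoʳ-≤-nonNeg (⁻¹-nonNeg 0≤c c≢0))

  *-⁻¹-≤⇔-nonPos : ∀ {c x y} → c ≤ 0# → c ≢ 0# → (x * c ⁻¹ ≤ y * c ⁻¹) ⇔ (y ≤ x)
  *-⁻¹-≤⇔-nonPos {c} {x} {y} c≤0 c≢0 = mk⇔
    (λ x/c≤y/c → subst₂ _≤_ (x*c⁻¹*c≡x c≢0 y) (x*c⁻¹*c≡x c≢0 x) (*-monoʳ-≤-nonPos c≤0 x/c≤y/c))
    (*-monoʳ-≤-nonPos (⁻¹-nonPos c≤0 c≢0))

  /-cross : ∀ {a b d e} → d ≢ 0# → e ≢ 0# → a * e ≡ b * d → a * d ⁻¹ ≡ b * e ⁻¹
  /-cross {a} {b} {d} {e} d≢0 e≢0 ae≡bd = begin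
    a * d ⁻¹                 ≡⟨ sym (x*c*[y*c⁻¹]≡x*y e≢0 a (d ⁻¹)) ⟩
    a * e * (d ⁻¹ * e ⁻¹)    ≡⟨ cong₂ _*_ ae≡bd (*-comm (d ⁻¹) (e ⁻¹)) ⟩
    b * d * (e ⁻¹ * d ⁻¹)    ≡⟨ x*c*[y*c⁻¹]≡x*y d≢0 b (e ⁻¹) ⟩
    b * e ⁻¹                 ∎

  /-mono-≤ : ∀ {a b d e} → 0# ≤ d → 0# ≤ e → d ≢ 0# → e ≢ 0# →
             a * e ≤ b * d → a * d ⁻¹ ≤ b * e ⁻¹
  /-mono-≤ {a} {b} {d} {e} 0≤d 0≤e d≢0 e≢0 ae≤bd =
    subst₂ _≤_ (x*c*[y*c⁻¹]≡x*y e≢0 a (d ⁻¹)) bd[d⁻¹e⁻¹]≡b/e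
      (*-monoʳ-≤-nonNeg (*-nonneg (⁻¹-nonNeg 0≤d d≢0) (⁻¹-nonNeg 0≤e e≢0)) ae≤bd)
    where
    bd[d⁻¹e⁻¹]≡b/e : b * d * (d ⁻¹ * e ⁻¹) ≡ b * e ⁻¹
    bd[d⁻¹e⁻¹]≡b/e = trans (cong (b * d *_) (*-comm (d ⁻¹) (e ⁻¹))) (x*c*[y*c⁻¹]≡x*y d≢0 b (e ⁻¹))

  /-*-/ : ∀ {a b d e} → d ≢ 0# → e ≢ 0# → a * b * (d * e) ⁻¹ ≡ a * d ⁻¹ * (b * e ⁻¹)
  /-*-/ {a} {b} {d} {e} d≢0 e≢0 =
    trans (cong (a * b *_) (⁻¹-* d≢0 e≢0)) (interchange a b (d ⁻¹) (e ⁻¹))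

module RationalEmbedding (ℝ : RealField) where
  open RealField ℝ
  open Semantics ℝ using (_∈I_)
  open OrderedFieldProperties ℝ
  open CommutativeRing commutativeRing using (+-identityʳ; semiring; ring)
  open import Algebra.Properties.Ring ring using (-‿distribˡ-*; -‿distribʳ-*; -‿involutive; -0#≈0#)
  open import Algebra.Properties.Semiring.Mult semiring using (×1-homo-*) renaming (_×_ to _×ℕ_)
  open Equivalence using (to; from)
  open ≡-Reasoning

  fromℕ≡×ℕ1# : ∀ n → fromℕ n ≡ n ×ℕ 1#
  fromℕ≡×ℕ1# zero    = refl
  fromℕ≡×ℕ1# (suc n) = cong (1# +_) (fromℕ≡×ℕ1# n)

  fromℕ-* : ∀ m n → fromℕ (m ℕ.* n) ≡ fromℕ m * fromℕ n
  fromℕ-* m n = begin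
    fromℕ (m ℕ.* n)        ≡⟨ fromℕ≡×ℕ1# (m ℕ.* n) ⟩
    (m ℕ.* n) ×ℕ 1#        ≡⟨ ×1-homo-* m n ⟩
    (m ×ℕ 1#) * (n ×ℕ 1#)  ≡⟨ sym (cong₂ _*_ (fromℕ≡×ℕ1# m) (fromℕ≡×ℕ1# n)) ⟩
    fromℕ m * fromℕ n      ∎

  fromℕ-nonNeg : ∀ n → 0# ≤ fromℕ n
  1≤fromℕ-suc : ∀ n → 1# ≤ fromℕ (suc n)

  fromℕ-nonNeg zero    = ≤-refl
  fromℕ-nonNeg (suc n) = ≤-trans 0≤1 (1≤fromℕ-suc n)

  1≤fromℕ-suc n = subst₂ _≤_ (+-identityʳ 1#) refl (+-monoʳ-≤ 1# (fromℕ-nonNeg n))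

  fromℕ-suc≢0 : ∀ n → fromℕ (suc n) ≢ 0#
  fromℕ-suc≢0 n 1+n≡0 = 0≢1 (antisym 0≤1 (subst (1# ≤_) 1+n≡0 (1≤fromℕ-suc n)))

  fromℕ-mono-≤ : ∀ {m n} → m ℕ.≤ n → fromℕ m ≤ fromℕ n
  fromℕ-mono-≤ {n = n} ℕ.z≤n = fromℕ-nonNeg n
  fromℕ-mono-≤ (ℕ.s≤s m≤n)   = +-monoʳ-≤ 1# (fromℕ-mono-≤ m≤n)

  fromℤ-neg : ∀ i → fromℤ (ℤ.- i) ≡ - fromℤ i
  fromℤ-neg (ℤ.+ zero)   = sym -0#≈0#
  fromℤ-neg (ℤ.+ suc n)  = refl
  fromℤ-neg ℤ.-[1+ n ]   = sym (-‿involutive (fromℕ (suc n)))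

  fromℤ-+-* : ∀ m j → fromℤ (ℤ.+ m ℤ.* j) ≡ fromℕ m * fromℤ j
  fromℤ-+-* m (ℤ.+ n)    = trans (cong fromℤ (sym (ℤ.pos-* m n))) (fromℕ-* m n)
  fromℤ-+-* m ℤ.-[1+ n ] = begin
    fromℤ (ℤ.+ m ℤ.* ℤ.-[1+ n ])          ≡⟨ cong fromℤ (sym (ℤ.neg-distribʳ-* (ℤ.+ m) (ℤ.+ suc n))) ⟩
    fromℤ (ℤ.- (ℤ.+ m ℤ.* ℤ.+ suc n))     ≡⟨ fromℤ-neg (ℤ.+ m ℤ.* ℤ.+ suc n) ⟩
    - fromℤ (ℤ.+ m ℤ.* ℤ.+ suc n)         ≡⟨ cong -_ (fromℤ-+-* m (ℤ.+ suc n)) ⟩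
    - (fromℕ m * fromℕ (suc n))           ≡⟨ -‿distribʳ-* (fromℕ m) (fromℕ (suc n)) ⟩
    fromℕ m * - fromℕ (suc n)             ∎

  fromℤ-* : ∀ i j → fromℤ (i ℤ.* j) ≡ fromℤ i * fromℤ j
  fromℤ-* (ℤ.+ m)    j = fromℤ-+-* m j
  fromℤ-* ℤ.-[1+ m ] j = begin
    fromℤ (ℤ.-[1+ m ] ℤ.* j)              ≡⟨ cong fromℤ (sym (ℤ.neg-distribˡ-* (ℤ.+ suc m) j)) ⟩
    fromℤ (ℤ.- (ℤ.+ suc m ℤ.* j))         ≡⟨ fromℤ-neg (ℤ.+ suc m ℤ.* j) ⟩
    - fromℤ (ℤ.+ suc m ℤ.* j)             ≡⟨ cong -_ (fromℤ-+-* (suc m) j) ⟩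
    - (fromℕ (suc m) * fromℤ j)           ≡⟨ -‿distribˡ-* (fromℕ (suc m)) (fromℤ j) ⟩
    - fromℕ (suc m) * fromℤ j             ∎

  fromℤ-mono-≤ : ∀ {i j} → i ℤ.≤ j → fromℤ i ≤ fromℤ j
  fromℤ-mono-≤ (ℤ.-≤- n≤m) = neg-antimono-≤ (fromℕ-mono-≤ (ℕ.s≤s n≤m))
  fromℤ-mono-≤ {ℤ.-[1+ m ]} {ℤ.+ n} ℤ.-≤+ =
    ≤-trans (0≤x⇒-x≤0 (fromℕ-nonNeg (suc m))) (fromℕ-nonNeg n)
  fromℤ-mono-≤ (ℤ.+≤+ m≤n) = fromℕ-mono-≤ m≤n

  -- The product of ℚ normalises; fromℚ is multiplicative because it factors through ℚᵘ,
  -- whose product is componentwise.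
  fromℚᵘ : ℚᵘ → Carrier
  fromℚᵘ p = fromℤ (ℚᵘ.↥ p) * fromℕ (ℚᵘ.↧ₙ p) ⁻¹

  fromℚᵘ-cong : ∀ {p q} → p ℚᵘ.≃ q → fromℚᵘ p ≡ fromℚᵘ q
  fromℚᵘ-cong {p} {q} (ℚᵘ.*≡* ↥p↧q≡↥q↧p) =
    /-cross (fromℕ-suc≢0 (ℚᵘ.ℚᵘ.denominator-1 p)) (fromℕ-suc≢0 (ℚᵘ.ℚᵘ.denominator-1 q)) (begin
      fromℤ (ℚᵘ.↥ p) * fromℕ (ℚᵘ.↧ₙ q)   ≡⟨ sym (fromℤ-* (ℚᵘ.↥ p) (ℚᵘ.↧ q)) ⟩
      fromℤ (ℚᵘ.↥ p ℤ.* ℚᵘ.↧ q)           ≡⟨ cong fromℤ ↥p↧q≡↥q↧p ⟩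
      fromℤ (ℚᵘ.↥ q ℤ.* ℚᵘ.↧ p)           ≡⟨ fromℤ-* (ℚᵘ.↥ q) (ℚᵘ.↧ p) ⟩
      fromℤ (ℚᵘ.↥ q) * fromℕ (ℚᵘ.↧ₙ p)   ∎)

  fromℚᵘ-* : ∀ p q → fromℚᵘ (p ℚᵘ.* q) ≡ fromℚᵘ p * fromℚᵘ q
  fromℚᵘ-* p@record{} q@record{} = begin
    fromℤ (ℚᵘ.↥ p ℤ.* ℚᵘ.↥ q) * fromℕ (ℚᵘ.↧ₙ p ℕ.* ℚᵘ.↧ₙ q) ⁻¹
      ≡⟨ cong₂ (λ n d → n * d ⁻¹) (fromℤ-* (ℚᵘ.↥ p) (ℚᵘ.↥ q)) (fromℕ-* (ℚᵘ.↧ₙ p) (ℚᵘ.↧ₙ q)) ⟩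
    fromℤ (ℚᵘ.↥ p) * fromℤ (ℚᵘ.↥ q) * (fromℕ (ℚᵘ.↧ₙ p) * fromℕ (ℚᵘ.↧ₙ q)) ⁻¹
      ≡⟨ /-*-/ (fromℕ-suc≢0 (ℚᵘ.ℚᵘ.denominator-1 p)) (fromℕ-suc≢0 (ℚᵘ.ℚᵘ.denominator-1 q)) ⟩
    fromℚᵘ p * fromℚᵘ q
      ∎

  fromℚ≡fromℚᵘ∘toℚᵘ : ∀ q → fromℚ q ≡ fromℚᵘ (ℚ.toℚᵘ q)
  fromℚ≡fromℚᵘ∘toℚᵘ record{} = refl

  fromℚ-* : ∀ p q → fromℚ (p ℚ.* q) ≡ fromℚ p * fromℚ q
  fromℚ-* p q = begin
    fromℚ (p ℚ.* q)                          ≡⟨ fromℚ≡fromℚᵘ∘toℚᵘ (p ℚ.* q) ⟩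
    fromℚᵘ (ℚ.toℚᵘ (p ℚ.* q))                ≡⟨ fromℚᵘ-cong (ℚ.toℚᵘ-homo-* p q) ⟩
    fromℚᵘ (ℚ.toℚᵘ p ℚᵘ.* ℚ.toℚᵘ q)          ≡⟨ fromℚᵘ-* (ℚ.toℚᵘ p) (ℚ.toℚᵘ q) ⟩
    fromℚᵘ (ℚ.toℚᵘ p) * fromℚᵘ (ℚ.toℚᵘ q)    ≡⟨ sym (cong₂ _*_ (fromℚ≡fromℚᵘ∘toℚᵘ p) (fromℚ≡fromℚᵘ∘toℚᵘ q)) ⟩
    fromℚ p * fromℚ q                         ∎

  fromℚ-1 : fromℚ 1ℚ ≡ 1#
  fromℚ-1 = ⁻¹-inverse (fromℕ 1) (fromℕ-suc≢0 0)

  fromℚ-*-1/ : ∀ f .{{_ : ℚ.NonZero f}} → fromℚ f * fromℚ (ℚ.1/ f) ≡ 1#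
  fromℚ-*-1/ f = trans (sym (fromℚ-* f (ℚ.1/ f))) (trans (cong fromℚ (ℚ.*-inverseʳ f)) fromℚ-1)

  fromℚ-≢0 : ∀ {f} → f ≢ 0ℚ → fromℚ f ≢ 0#
  fromℚ-≢0 {f} f≢0 = x*y≡1⇒x≢0 (fromℚ-*-1/ f {{ℚ.≢-nonZero f≢0}})

  fromℚ-/ℚ : ∀ c {f} → f ≢ 0ℚ → fromℚ (c /ℚ f) ≡ fromℚ c * fromℚ f ⁻¹
  fromℚ-/ℚ c {f} f≢0 with f ℚ.≟ 0ℚ
  ... | yes f≡0 = contradiction f≡0 f≢0
  ... | no f≢0′ = trans (fromℚ-* c (ℚ.1/ f)) (cong (fromℚ c *_) (⁻¹-unique (fromℚ-*-1/ f)))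
    where instance _ = ℚ.≢-nonZero f≢0′

  fromℚ-mono-≤ : ∀ {p q} → p ℚ.≤ q → fromℚ p ≤ fromℚ q
  fromℚ-mono-≤ {p} {q} (ℚ.*≤* ↥p↧q≤↥q↧p) =
    /-mono-≤ (fromℕ-nonNeg (ℚ.↧ₙ p)) (fromℕ-nonNeg (ℚ.↧ₙ q))
             (fromℕ-suc≢0 (ℚ.ℚ.denominator-1 p)) (fromℕ-suc≢0 (ℚ.ℚ.denominator-1 q))
             (subst₂ _≤_ (fromℤ-* (ℚ.↥ p) (ℚ.↧ q)) (fromℤ-* (ℚ.↥ q) (ℚ.↧ p)) (fromℤ-mono-≤ ↥p↧q≤↥q↧p))

  fromℚ-⊓ : ∀ p q → fromℚ p ≤ fromℚ q → fromℚ (p ℚ.⊓ q) ≡ fromℚ p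
  fromℚ-⊓ p q p≤q with ℚ.≤-total p q
  ... | inj₁ p≤ℚq = cong fromℚ (ℚ.p≤q⇒p⊓q≡p p≤ℚq)
  ... | inj₂ q≤ℚp = trans (cong fromℚ (ℚ.p≥q⇒p⊓q≡q q≤ℚp)) (antisym (fromℚ-mono-≤ q≤ℚp) p≤q)

  fromℚ-⊔ : ∀ p q → fromℚ p ≤ fromℚ q → fromℚ (p ℚ.⊔ q) ≡ fromℚ q
  fromℚ-⊔ p q p≤q with ℚ.≤-total p q
  ... | inj₁ p≤ℚq = cong fromℚ (ℚ.p≤q⇒p⊔q≡q p≤ℚq)
  ... | inj₂ q≤ℚp = trans (cong fromℚ (ℚ.p≥q⇒p⊔q≡p q≤ℚp)) (antisym p≤q (fromℚ-mono-≤ q≤ℚp))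

  ∈-scaleInterval : ∀ {a b f} → a ℚ.≤ b → f ≢ 0ℚ → ∀ r →
                    ((r * fromℚ f ⁻¹) ∈I scaleInterval [ a , b ] f) ⇔ (r ∈I [ a , b ])
  ∈-scaleInterval {a} {b} {f} a≤b f≢0 r with total 0# (fromℚ f)
  ... | inj₁ 0≤c =
    subst₂ (λ lo hi → ((lo ≤ r * c ⁻¹) × (r * c ⁻¹ ≤ hi)) ⇔ (r ∈I [ a , b ])) (sym lo≡a/c) (sym hi≡b/c)
      (*-⁻¹-≤⇔-nonNeg 0≤c c≢0 ×-⇔ *-⁻¹-≤⇔-nonNeg 0≤c c≢0)
    where
    c = fromℚ f
    c≢0 = fromℚ-≢0 f≢0
    a/f≤b/f : fromℚ (a /ℚ f) ≤ fromℚ (b /ℚ f)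
    a/f≤b/f = subst₂ _≤_ (sym (fromℚ-/ℚ a f≢0)) (sym (fromℚ-/ℚ b f≢0))
                (from (*-⁻¹-≤⇔-nonNeg 0≤c c≢0) (fromℚ-mono-≤ a≤b))
    lo≡a/c : fromℚ ((a /ℚ f) ℚ.⊓ (b /ℚ f)) ≡ fromℚ a * c ⁻¹
    lo≡a/c = trans (fromℚ-⊓ (a /ℚ f) (b /ℚ f) a/f≤b/f) (fromℚ-/ℚ a f≢0)
    hi≡b/c : fromℚ ((a /ℚ f) ℚ.⊔ (b /ℚ f)) ≡ fromℚ b * c ⁻¹
    hi≡b/c = trans (fromℚ-⊔ (a /ℚ f) (b /ℚ f) a/f≤b/f) (fromℚ-/ℚ b f≢0)
  ... | inj₂ c≤0 =
    subst₂ (λ lo hi → ((lo ≤ r * c ⁻¹) × (r * c ⁻¹ ≤ hi)) ⇔ (r ∈I [ a , b ])) (sym lo≡b/c) (sym hi≡a/c)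
      (⇔.trans (*-⁻¹-≤⇔-nonPos c≤0 c≢0 ×-⇔ *-⁻¹-≤⇔-nonPos c≤0 c≢0) (mk⇔ swap swap))
    where
    c = fromℚ f
    c≢0 = fromℚ-≢0 f≢0
    b/f≤a/f : fromℚ (b /ℚ f) ≤ fromℚ (a /ℚ f)
    b/f≤a/f = subst₂ _≤_ (sym (fromℚ-/ℚ b f≢0)) (sym (fromℚ-/ℚ a f≢0))
                (from (*-⁻¹-≤⇔-nonPos c≤0 c≢0) (fromℚ-mono-≤ a≤b))
    lo≡b/c : fromℚ ((a /ℚ f) ℚ.⊓ (b /ℚ f)) ≡ fromℚ b * c ⁻¹
    lo≡b/c = trans (cong fromℚ (ℚ.⊓-comm (a /ℚ f) (b /ℚ f)))
                   (trans (fromℚ-⊓ (b /ℚ f) (a /ℚ f) b/f≤a/f) (fromℚ-/ℚ b f≢0))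
    hi≡a/c : fromℚ ((a /ℚ f) ℚ.⊔ (b /ℚ f)) ≡ fromℚ a * c ⁻¹
    hi≡a/c = trans (cong fromℚ (ℚ.⊔-comm (a /ℚ f) (b /ℚ f)))
                   (trans (fromℚ-⊔ (b /ℚ f) (a /ℚ f) b/f≤a/f) (fromℚ-/ℚ a f≢0))

module Normalization (ℝ : RealField) {n₁ n₂ nX nA nO : ℕ} (G : Game n₁ n₂ nX nA nO) where
  open RealField ℝ
  open Semantics ℝ
  open Game G
  open OrderedFieldProperties ℝ using (commutativeRing; x*c*c⁻¹≡x)
  open RationalEmbedding ℝ using (fromℚ-1; fromℚ-≢0; fromℚ-/ℚ; ∈-scaleInterval)
  open CommutativeRing commutativeRing using (*-identityʳ; zeroˡ; distribʳ)
  open Equivalence using (to; from)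
  open ≡-Reasoning

  Valuation : Set
  Valuation = Fin nX → Carrier

  delay : Game n₁ n₂ nX nA nO → Loc n₁ n₂ → Valuation → Carrier → Valuation
  delay H l v t x = v x + t * fromℚ (Game.flow H l x)

  jump : Game n₁ n₂ nX nA nO → Edge n₁ n₂ nX nA → Valuation → Carrier → Valuation
  jump H e v t x = resetVal (Edge.rst e x) (delay H (Edge.src e) v t x)

  ★ : Loc n₁ n₂ → Fin nX → Carrier → Carrier
  ★ = star G ℝ

  _≈★_at_ : Valuation → Valuation → Loc n₁ n₂ → Set
  w ≈★ v at l = ∀ x → w x ≡ ★ l x (v x)

  W : Game n₁ n₂ nX nA nO
  W = normalize G

  ★-0 : ∀ l x → ★ l x 0# ≡ 0#
  ★-0 l x with flow l x ℚ.≟ 0ℚ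
  ... | yes _ = refl
  ... | no  _ = zeroˡ _

  ★-cong-flow : ∀ {l l′ x} → flow l x ≡ flow l′ x → ∀ r → ★ l x r ≡ ★ l′ x r
  ★-cong-flow {l} {l′} {x} same-flow r with flow l x ℚ.≟ 0ℚ | flow l′ x ℚ.≟ 0ℚ
  ... | yes _   | yes _    = refl
  ... | no _    | no _     = cong (λ f → r * fromℚ f ⁻¹) same-flow
  ... | yes f≡0 | no f′≢0  = contradiction (trans (sym same-flow) f≡0) f′≢0
  ... | no f≢0  | yes f′≡0 = contradiction (trans same-flow f′≡0) f≢0

  ★-delay : ∀ l x u t → ★ l x u + t * fromℚ (flowW G l x) ≡ ★ l x (u + t * fromℚ (flow l x))
  ★-delay l x u t with flow l x ℚ.≟ 0ℚ
  ... | yes f≡0 = cong (λ f → u + t * fromℚ f) (sym f≡0)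
  ... | no  f≢0 = begin
    u * c ⁻¹ + t * fromℚ 1ℚ     ≡⟨ cong (λ z → u * c ⁻¹ + t * z) fromℚ-1 ⟩
    u * c ⁻¹ + t * 1#           ≡⟨ cong (u * c ⁻¹ +_) (*-identityʳ t) ⟩
    u * c ⁻¹ + t                ≡⟨ cong (u * c ⁻¹ +_) (sym (x*c*c⁻¹≡x (fromℚ-≢0 f≢0) t)) ⟩
    u * c ⁻¹ + t * c * c ⁻¹     ≡⟨ sym (distribʳ (c ⁻¹) u (t * c)) ⟩
    (u + t * c) * c ⁻¹          ∎
    where c = fromℚ (flow l x)

  delay-≈★ : ∀ {l w v} → w ≈★ v at l → ∀ t → delay W l w t ≈★ delay G l v t at l
  delay-≈★ {l} {w} {v} w≈★v t x =
    trans (cong (_+ t * fromℚ (flowW G l x)) (w≈★v x)) (★-delay l x (v x) t)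

  ★-∈-guardW : ∀ l x {I} → Interval.lo I ℚ.≤ Interval.hi I → ∀ r →
               (★ l x r ∈I guardW G l I x) ⇔ (r ∈I I)
  ★-∈-guardW l x {[ a , b ]} a≤b r with flow l x ℚ.≟ 0ℚ
  ... | yes _   = ⇔.refl
  ... | no  f≢0 = ∈-scaleInterval a≤b f≢0 r

  resetVal-rstW : ∀ {l l′ x} rst → (flow l x ≢ flow l′ x → rst ≢ nothing) → ∀ r →
                  resetVal (rstW G l′ rst x) (★ l x r) ≡ ★ l′ x (resetVal rst r)
  resetVal-rstW {l′ = l′} {x} (just c) _ r with flow l′ x ℚ.≟ 0ℚ
  ... | yes _   = refl
  ... | no  f≢0 = fromℚ-/ℚ c f≢0
  resetVal-rstW {l} {l′} {x} nothing flow-change⇒reset r with flow l x ℚ.≟ flow l′ x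
  ... | yes same-flow   = ★-cong-flow same-flow r
  ... | no  flow-change = contradiction refl (flow-change⇒reset flow-change)

  γ₁⁻¹-initial : γ₁⁻¹ G ℝ (initial W) (initial G)
  γ₁⁻¹-initial = refl , λ x → sym (★-0 (inj₁ l₀) x)

  module _ (wf : WellFormed G) where

    ∈-guard-edgeW : ∀ {e w v} → e ∈ edges → w ≈★ v at Edge.src e → ∀ t x →
                    (delay W (Edge.src e) w t x ∈I Edge.guard (edgeW G e) x)
                  ⇔ (delay G (Edge.src e) v t x ∈I Edge.guard e x)
    ∈-guard-edgeW {e} {w} {v} e∈ w≈★v t x =
      subst (λ r → (r ∈I Edge.guard (edgeW G e) x) ⇔ (delay G (Edge.src e) v t x ∈I Edge.guard e x))
            (sym (delay-≈★ w≈★v t x))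
            (★-∈-guardW (Edge.src e) x (proj₁ (wf e e∈) x) _)

    jump-≈★ : ∀ {e w v} → e ∈ edges → w ≈★ v at Edge.src e → ∀ t →
              jump W (edgeW G e) w t ≈★ jump G e v t at Edge.tgt e
    jump-≈★ {e} e∈ w≈★v t x =
      trans (cong (resetVal (Edge.rst (edgeW G e) x)) (delay-≈★ w≈★v t x))
            (resetVal-rstW (Edge.rst e x) (proj₂ (wf e e∈) x) _)

    simulate-W-step : ∀ {l w v} → w ≈★ v at l → ∀ m p′ → Step W (l , w) m p′ →
                      Σ _ λ m′ → Σ _ λ q′ → Step G (l , v) m′ q′ × γ₁⁻¹ G ℝ p′ q′
    simulate-W-step {v = v} w≈★v (a , t) (l′ , w′) (0≤t , eW , eW∈ , refl , act≡a , refl , fires)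
      with ∈-map⁻ (edgeW G) eW∈
    ... | e , e∈ , refl =
      (a , t) , (Edge.tgt e , jump G e v t) ,
      (0≤t , e , e∈ , refl , act≡a , refl ,
       λ x → to (∈-guard-edgeW e∈ w≈★v t x) (proj₁ (fires x)) , refl) ,
      refl , λ x → trans (proj₂ (fires x)) (jump-≈★ e∈ w≈★v t x)

    simulate-G-step : ∀ {l w v} → w ≈★ v at l → ∀ m′ q′ → Step G (l , v) m′ q′ →
                      Σ _ λ m → Σ _ λ p′ → Step W (l , w) m p′ × γ₁⁻¹ G ℝ p′ q′
    simulate-G-step {w = w} w≈★v (a , t) (l′ , v′) (0≤t , e , e∈ , refl , act≡a , refl , fires) =
      (a , t) , (Edge.tgt e , jump W (edgeW G e) w t) ,
      (0≤t , edgeW G e , ∈-map⁺ (edgeW G) e∈ , refl , act≡a , refl ,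
       λ x → from (∈-guard-edgeW e∈ w≈★v t x) (proj₁ (fires x)) , refl) ,
      refl , λ x → trans (jump-≈★ e∈ w≈★v t x) (cong (★ (Edge.tgt e) x) (sym (proj₂ (fires x))))

    γ₁⁻¹-isAltSimulation : IsAltSimulation W G (γ₁⁻¹ G ℝ)
    γ₁⁻¹-isAltSimulation (l , w) (.l , v) (refl , w≈★v) =
      refl , refl , (λ _ → simulate-W-step w≈★v) , (λ _ → simulate-G-step w≈★v)

lemma4 : (ℝ : RealField) {n₁ n₂ nX nA nO : ℕ} (G : Game n₁ n₂ nX nA nO) →
         WellFormed G →
         Semantics.Witnesses ℝ (normalize G) G (γ₁⁻¹ G ℝ)
lemma4 ℝ G wf = Normalization.γ₁⁻¹-isAltSimulation ℝ G wf , Normalization.γ₁⁻¹-initial ℝ G
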